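{- Let $j\ge1$ and $a_{j+2}\ge1$ be odd integers with $j=1$ or $a_{j+2}=1$. Then the tree $RT(0^j,1,a_{j+2})$ is not super edge-graceful.
   Context: For a finite simple graph $G$ with $p$ vertices and $q$ edges, $G$ is super edge-graceful if there is a bijection $f$ from $E(G)$ onto $\{0,\pm1,\ldots,\pm\frac{q-1}{2}\}$ when $q$ is odd, and onto $\{\pm1,\ldots,\pm\frac{q}{2}\}$ when $q$ is even, such that the induced vertex labeling $f^+(v)=\sum_{uv\in E(G)} f(uv)$ is a bijection from $V(G)$ onto $\{0,\pm1,\ldots,\pm\frac{p-1}{2}\}$ when $p$ is odd, and onto $\{\pm1,\ldots,\pm\frac{p}{2}\}$ when $p$ is even. $RT(0^j,a,b)$ denotes the rooted tree with root $v_0$ having $j+2$ children: $j$ of them are leaves, one has exactly $a$ children (all leaves) and one has exactly $b$ children (all leaves). -}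

module Defs where

open import Data.Nat as ℕ using (ℕ; zero; suc; _+_; _*_; _<_; s≤s; z≤n; _<ᵇ_)
open import Data.Nat.Properties using (m≤m+n; m≤n⇒m≤1+n)
open import Data.Integer as ℤ using (ℤ; ∣_∣)
open import Data.Fin using (Fin; zero; suc; toℕ; fromℕ<; _≟_)
open import Data.Bool using (Bool; if_then_else_; _∨_)
open import Data.Product using (_×_; _,_; proj₁; proj₂; ∃)
open import Relation.Nullary using (¬_)
open import Relation.Nullary.Decidable using (⌊_⌋)
open import Relation.Binary.PropositionalEquality using (_≡_)
open import Function.Definitions using (Injective)

Odd : ℕ → Set
Odd n = ∃ λ k → n ≡ suc (2 * k)

Even : ℕ → Set
Even n = ∃ λ k → n ≡ 2 * k

record Graph : Set where
  field
    p    : ℕ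
    q    : ℕ
    ends : Fin q → Fin p × Fin p
open Graph public

-- The label set for n items:
--   n odd  (n = 2k+1) : {0, ±1, …, ±k}
--   n even (n = 2k)   : {±1, …, ±k}
-- i.e. |x| ≤ ⌊n/2⌋, and x ≠ 0 when n is even.
LabelSet : ℕ → ℤ → Set
LabelSet n x = (∣ x ∣ ℕ.≤ n ℕ./ 2) × (Even n → ¬ (x ≡ ℤ.0ℤ))

BijOnto : {n : ℕ} → (Fin n → ℤ) → (ℤ → Set) → Set
BijOnto {n} g S =
  (∀ i → S (g i)) × Injective _≡_ _≡_ g × (∀ x → S x → ∃ λ i → g i ≡ x)

sumFin : (n : ℕ) → (Fin n → ℤ) → ℤ
sumFin zero    h = ℤ.0ℤ
sumFin (suc n) h = h zero ℤ.+ sumFin n (λ i → h (suc i))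

incident : (G : Graph) → Fin (p G) → Fin (q G) → Bool
incident G v e = ⌊ v ≟ proj₁ (ends G e) ⌋ ∨ ⌊ v ≟ proj₂ (ends G e) ⌋

vertexSum : (G : Graph) → (Fin (q G) → ℤ) → Fin (p G) → ℤ
vertexSum G f v = sumFin (q G) (λ e → if incident G v e then f e else ℤ.0ℤ)

SuperEdgeGraceful : Graph → Set
SuperEdgeGraceful G =
  ∃ λ (f : Fin (q G) → ℤ) →
    BijOnto f (LabelSet (q G)) × BijOnto (vertexSum G f) (LabelSet (p G))

-- Vertices (p = j+a+b+3):  0 = root v₀;  1..j+2 = children of the root,
-- where j+1 is the child with a leaf children and j+2 the child with b leaf
-- children (1..j are leaves);  j+3..j+a+2 are the a children of vertex j+1;
-- j+a+3..j+a+b+2 are the b children of vertex j+2.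
-- Edge i (0 ≤ i < q = j+a+b+2) joins vertex i+1 to its parent.
RT : (j a b : ℕ) → Graph
RT j a b = record { p = suc q' ; q = q' ; ends = e }
  where
  n  = j + (a + b)
  q' = suc (suc n)
  u : Fin (suc q')
  u = fromℕ< {suc j} (s≤s (s≤s (m≤n⇒m≤1+n (m≤m+n j (a + b)))))
  w : Fin (suc q')
  w = fromℕ< {suc (suc j)} (s≤s (s≤s (s≤s (m≤m+n j (a + b)))))
  parent : Fin q' → Fin (suc q')
  parent i = if toℕ i <ᵇ suc (suc j) then zero
             else if toℕ i <ᵇ suc (suc (j + a)) then u
             else w
  e : Fin q' → Fin (suc q') × Fin (suc q')
  e i = parent i , suc i

module Submission where

-- For odd j, b the tree has q = j+b+3 edges (odd) and p = q+1 vertices (even),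
-- so a super edge-graceful labelling uses every edge label in {0,±1,…,±k},
-- k = ⌊q/2⌋, and every vertex label in {±1,…,±(k+1)}; in particular some edge
-- e₀ is labelled 0 while no vertex is.  A leaf carries the label of its edge,
-- so e₀ joins the root v₀ to u (the child with one leaf child c) or to w (the
-- child with b leaf children).  If e₀ = v₀u then u and c both carry the label
-- of uc, contradicting injectivity; the same happens for e₀ = v₀w when b = 1.
-- If e₀ = v₀w and j = 1, every label of absolute value ≤ k other than the label
-- of v₀u is taken by a leaf or is 0, so v₀ and u, whose labels differ from it,
-- get the two labels ±(k+1).  Their difference is the difference of two edge
-- labels, of absolute value ≤ 2k < 2(k+1): contradiction.

open import Defs
open import Data.Nat using (ℕ)
open import Data.Sum using (_⊎_)
open import Relation.Nullary using (¬_)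
open import Relation.Binary.PropositionalEquality using (_≡_)

open import Data.Nat as ℕ using (zero; suc; _<ᵇ_; _<_; _≤_; s≤s; z≤n)
import Data.Nat.Properties as ℕP
open import Data.Nat.DivMod using (_/_; /-monoˡ-≤; m/n≡1+[m∸n]/n)
open import Data.Nat.Tactic.RingSolver using () renaming (solve-∀ to solve-ℕ)
open import Data.Integer as ℤ using (ℤ; ∣_∣; 0ℤ; _+_; _-_)
import Data.Integer.Properties as ℤP
open import Data.Integer.Tactic.RingSolver using () renaming (solve-∀ to solve-ℤ)
open import Algebra.Properties.AbelianGroup ℤP.+-0-abelianGroup
  using (identityˡ-unique; identityʳ-unique)
open import Data.Fin using (Fin; zero; suc; toℕ; fromℕ<; _≟_; _↑ˡ_; _↑ʳ_)
import Data.Fin.Properties as FP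
open import Data.Bool using (true; false; if_then_else_; _∨_)
open import Data.Product using (_×_; _,_; proj₁; proj₂; ∃)
open import Data.Sum using (inj₁; inj₂; [_,_])
open import Data.Empty using (⊥-elim)
open import Function using (_∘_)
open import Relation.Nullary using (Dec; does; yes; no)
open import Relation.Nullary.Decidable using (_⊎-dec_; dec-true; dec-false; isYes≗does)
open import Relation.Binary.PropositionalEquality
  using (_≢_; refl; sym; trans; cong; cong₂; subst; module ≡-Reasoning)

sumFin-cong : ∀ n {g h : Fin n → ℤ} → (∀ i → g i ≡ h i) → sumFin n g ≡ sumFin n h
sumFin-cong zero    g≗h = refl
sumFin-cong (suc n) g≗h = cong₂ _+_ (g≗h zero) (sumFin-cong n (g≗h ∘ suc))

sumFin-zero : ∀ n (g : Fin n → ℤ) → (∀ i → g i ≡ 0ℤ) → sumFin n g ≡ 0ℤ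
sumFin-zero zero    g g≗0 = refl
sumFin-zero (suc n) g g≗0 = cong₂ _+_ (g≗0 zero) (sumFin-zero n (g ∘ suc) (g≗0 ∘ suc))

sumFin-single : ∀ n (g : Fin n → ℤ) i → (∀ e → e ≢ i → g e ≡ 0ℤ) → sumFin n g ≡ g i
sumFin-single (suc n) g zero others = begin
  g zero + sumFin n (g ∘ suc) ≡⟨ cong (g zero +_) (sumFin-zero n (g ∘ suc) (λ e → others (suc e) λ ())) ⟩
  g zero + 0ℤ                 ≡⟨ ℤP.+-identityʳ (g zero) ⟩
  g zero                      ∎
  where open ≡-Reasoning
sumFin-single (suc n) g (suc i) others = begin
  g zero + sumFin n (g ∘ suc) ≡⟨ cong₂ _+_ (others zero λ ())
                                   (sumFin-single n (g ∘ suc) i λ e e≢i → others (suc e) (e≢i ∘ FP.suc-injective)) ⟩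
  0ℤ + g (suc i)              ≡⟨ ℤP.+-identityˡ (g (suc i)) ⟩
  g (suc i)                   ∎
  where open ≡-Reasoning

sumFin-pair : ∀ n (g : Fin n → ℤ) i i′ → i ≢ i′ → (∀ e → e ≢ i → e ≢ i′ → g e ≡ 0ℤ) →
              sumFin n g ≡ g i + g i′
sumFin-pair (suc n) g zero zero i≢i′ _ = ⊥-elim (i≢i′ refl)
sumFin-pair (suc n) g zero (suc i′) _ others =
  cong (g zero +_) (sumFin-single n (g ∘ suc) i′ λ e e≢i′ → others (suc e) (λ ()) (e≢i′ ∘ FP.suc-injective))
sumFin-pair (suc n) g (suc i) zero _ others =
  trans (cong (g zero +_) (sumFin-single n (g ∘ suc) i λ e e≢i → others (suc e) (e≢i ∘ FP.suc-injective) (λ ())))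
        (ℤP.+-comm (g zero) (g (suc i)))
sumFin-pair (suc n) g (suc i) (suc i′) i≢i′ others = begin
  g zero + sumFin n (g ∘ suc)   ≡⟨ cong₂ _+_ (others zero (λ ()) (λ ()))
                                     (sumFin-pair n (g ∘ suc) i i′ (i≢i′ ∘ cong suc) λ e e≢i e≢i′ →
                                        others (suc e) (e≢i ∘ FP.suc-injective) (e≢i′ ∘ FP.suc-injective)) ⟩
  0ℤ + (g (suc i) + g (suc i′)) ≡⟨ ℤP.+-identityˡ _ ⟩
  g (suc i) + g (suc i′)        ∎
  where open ≡-Reasoning

sumFin-split : ∀ m n (g : Fin (m ℕ.+ n) → ℤ) →
               sumFin (m ℕ.+ n) g ≡ sumFin m (λ i → g (i ↑ˡ n)) + sumFin n (λ i → g (m ↑ʳ i))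
sumFin-split zero    n g = sym (ℤP.+-identityˡ _)
sumFin-split (suc m) n g =
  trans (cong (g zero +_) (sumFin-split m n (g ∘ suc))) (sym (ℤP.+-assoc (g zero) _ _))

Incident : (G : Graph) → Fin (p G) → Fin (q G) → Set
Incident G v e = v ≡ proj₁ (ends G e) ⊎ v ≡ proj₂ (ends G e)

contribution : (G : Graph) → (Fin (q G) → ℤ) → Fin (p G) → Fin (q G) → ℤ
contribution G f v e = if incident G v e then f e else 0ℤ

incident? : ∀ G v e → Dec (Incident G v e)
incident? G v e = (v ≟ proj₁ (ends G e)) ⊎-dec (v ≟ proj₂ (ends G e))

incident≡does : ∀ G v e → incident G v e ≡ does (incident? G v e)
incident≡does G v e = cong₂ _∨_ (isYes≗does (v ≟ proj₁ (ends G e))) (isYes≗does (v ≟ proj₂ (ends G e)))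

incident-true : ∀ G {v e} → Incident G v e → incident G v e ≡ true
incident-true G {v} {e} inc = trans (incident≡does G v e) (dec-true (incident? G v e) inc)

incident-false : ∀ G {v e} → ¬ Incident G v e → incident G v e ≡ false
incident-false G {v} {e} ¬inc = trans (incident≡does G v e) (dec-false (incident? G v e) ¬inc)

contribution-present : ∀ G f {v e} → Incident G v e → contribution G f v e ≡ f e
contribution-present G f inc rewrite incident-true G inc = refl

contribution-absent : ∀ G f {v e} → ¬ Incident G v e → contribution G f v e ≡ 0ℤ
contribution-absent G f ¬inc rewrite incident-false G ¬inc = refl

vertexSum-single : ∀ G f {v e} → Incident G v e → (∀ e′ → e′ ≢ e → ¬ Incident G v e′) →
                   vertexSum G f v ≡ f e
vertexSum-single G f {v} {e} inc others =
  trans (sumFin-single (q G) (contribution G f v) e λ e′ e′≢e → contribution-absent G f (others e′ e′≢e))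
        (contribution-present G f inc)

vertexSum-pair : ∀ G f {v e e′} → e ≢ e′ → Incident G v e → Incident G v e′ →
                 (∀ e″ → e″ ≢ e → e″ ≢ e′ → ¬ Incident G v e″) → vertexSum G f v ≡ f e + f e′
vertexSum-pair G f {v} {e} {e′} e≢e′ inc inc′ others =
  trans (sumFin-pair (q G) (contribution G f v) e e′ e≢e′ λ e″ ne ne′ →
           contribution-absent G f (others e″ ne ne′))
        (cong₂ _+_ (contribution-present G f inc) (contribution-present G f inc′))

-- ⌊(n+1)/2⌋ ≤ ⌊n/2⌋ + 1: the vertex labels of a tree exceed its edge labels by at most one.
half-suc : ∀ n → suc n / 2 ≤ suc (n / 2)
half-suc n = ℕP.≤-trans (/-monoˡ-≤ 2 (ℕP.n≤1+n (suc n))) (ℕP.≤-reflexive (m/n≡1+[m∸n]/n {suc (suc n)} {2} (s≤s (s≤s z≤n))))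

module Graceful (G : Graph) (σ : SuperEdgeGraceful G) where

  label : Fin (q G) → ℤ
  label = proj₁ σ

  vertexLabel : Fin (p G) → ℤ
  vertexLabel = vertexSum G label

  label-bound : ∀ e → ∣ label e ∣ ≤ q G / 2
  label-bound e = proj₁ (proj₁ (proj₁ (proj₂ σ)) e)

  label-onto : ¬ Even (q G) → ∀ x → ∣ x ∣ ≤ q G / 2 → ∃ λ e → label e ≡ x
  label-onto odd x bound = proj₂ (proj₂ (proj₁ (proj₂ σ))) x (bound , λ even → ⊥-elim (odd even))

  zero-edge : ¬ Even (q G) → ∃ λ e → label e ≡ 0ℤ
  zero-edge odd = label-onto odd 0ℤ z≤n

  vertexLabel-injective : ∀ {v w} → vertexLabel v ≡ vertexLabel w → v ≡ w
  vertexLabel-injective = proj₁ (proj₂ (proj₂ (proj₂ σ)))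

  vertexLabel-nonzero : Even (p G) → ∀ v → vertexLabel v ≢ 0ℤ
  vertexLabel-nonzero even v = proj₂ (proj₁ (proj₂ (proj₂ σ)) v) even

  vertexLabel-bound : p G ≡ suc (q G) → ∀ v → ∣ vertexLabel v ∣ ≤ suc (q G / 2)
  vertexLabel-bound p≡ v =
    ℕP.≤-trans (subst (λ n → ∣ vertexLabel v ∣ ≤ n / 2) p≡ (proj₁ (proj₁ (proj₂ (proj₂ σ)) v)))
               (half-suc (q G))

  zero-summand : ∀ {x y e e′} → x ≢ y → vertexLabel x ≡ label e + label e′ →
                 vertexLabel y ≡ label e′ → label e ≢ 0ℤ
  zero-summand {x} {y} {e} {e′} x≢y x-sum y-label e↦0 = x≢y (vertexLabel-injective (begin
    vertexLabel x      ≡⟨ x-sum ⟩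
    label e + label e′ ≡⟨ cong (_+ label e′) e↦0 ⟩
    0ℤ + label e′      ≡⟨ ℤP.+-identityˡ (label e′) ⟩
    label e′           ≡⟨ sym y-label ⟩
    vertexLabel y      ∎))
    where open ≡-Reasoning

parentIndex : ℕ → ℕ → ℕ → ℕ
parentIndex j a t =
  if t <ᵇ suc (suc j) then 0 else if t <ᵇ suc (suc (j ℕ.+ a)) then suc j else suc (suc j)

toℕ-parent : ∀ j a b e → toℕ (proj₁ (ends (RT j a b) e)) ≡ parentIndex j a (toℕ e)
toℕ-parent j a b e with toℕ e <ᵇ suc (suc j)
... | true = refl
... | false with toℕ e <ᵇ suc (suc (j ℕ.+ a))
...   | true  = FP.toℕ-fromℕ< (s≤s (s≤s (ℕP.m≤n⇒m≤1+n (ℕP.m≤m+n j (a ℕ.+ b)))))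
...   | false = FP.toℕ-fromℕ< (s≤s (s≤s (s≤s (ℕP.m≤m+n j (a ℕ.+ b)))))

parent-root : ∀ {j a t} → t < suc (suc j) → parentIndex j a t ≡ 0
parent-root {j} {a} {t} t<2+j rewrite dec-true (t ℕP.<? suc (suc j)) t<2+j = refl

parent-u : ∀ {j a t} → ¬ t < suc (suc j) → t < suc (suc (j ℕ.+ a)) → parentIndex j a t ≡ suc j
parent-u {j} {a} {t} t≮2+j t<2+j+a
  rewrite dec-false (t ℕP.<? suc (suc j)) t≮2+j | dec-true (t ℕP.<? suc (suc (j ℕ.+ a))) t<2+j+a = refl

parent-w : ∀ {j a t} → ¬ t < suc (suc (j ℕ.+ a)) → parentIndex j a t ≡ suc (suc j)
parent-w {j} {a} {t} t≮2+j+a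
  rewrite dec-false (t ℕP.<? suc (suc j)) (t≮2+j+a ∘ λ t<2+j → ℕP.≤-trans t<2+j (s≤s (s≤s (ℕP.m≤m+n j a))))
        | dec-false (t ℕP.<? suc (suc (j ℕ.+ a))) t≮2+j+a = refl

parent-cases : ∀ j a t →
    t < suc (suc j) × parentIndex j a t ≡ 0
  ⊎ (¬ t < suc (suc j)) × t < suc (suc (j ℕ.+ a)) × parentIndex j a t ≡ suc j
  ⊎ (¬ t < suc (suc (j ℕ.+ a))) × parentIndex j a t ≡ suc (suc j)
parent-cases j a t with t ℕP.<? suc (suc j) | t ℕP.<? suc (suc (j ℕ.+ a))
... | yes t<2+j | _            = inj₁ (t<2+j , parent-root t<2+j)
... | no t≮2+j  | yes t<2+j+a  = inj₂ (inj₁ (t≮2+j , t<2+j+a , parent-u t≮2+j t<2+j+a))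
... | no _      | no t≮2+j+a   = inj₂ (inj₂ (t≮2+j+a , parent-w t≮2+j+a))

incident-RT : ∀ {j a b v e} → Incident (RT j a b) v e → v ≡ suc e ⊎ toℕ v ≡ parentIndex j a (toℕ e)
incident-RT {j} {a} {b} {e = e} (inj₁ v≡parent) = inj₂ (trans (cong toℕ v≡parent) (toℕ-parent j a b e))
incident-RT (inj₂ v≡child) = inj₁ v≡child

incident-parent : ∀ {j a b v e} → toℕ v ≡ parentIndex j a (toℕ e) → Incident (RT j a b) v e
incident-parent {j} {a} {b} {e = e} v≡parent = inj₁ (FP.toℕ-injective (trans v≡parent (sym (toℕ-parent j a b e))))

not-incident-RT : ∀ {j a b v e} → v ≢ suc e → toℕ v ≢ parentIndex j a (toℕ e) → ¬ Incident (RT j a b) v e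
not-incident-RT v≢child v≢parent inc = [ v≢child , v≢parent ] (incident-RT inc)

toℕ-distinct : ∀ {n} {x y : Fin n} {m m′} → toℕ x ≡ m → toℕ y ≡ m′ → m ≢ m′ → x ≢ y
toℕ-distinct x≡m y≡m′ m≢m′ x≡y = m≢m′ (trans (sym x≡m) (trans (cong toℕ x≡y) y≡m′))

-- The child end of every edge other than v₀u and v₀w is a leaf, so it
-- carries the label of that edge.
leaf-sum : ∀ j a b f i → toℕ i ≢ j → toℕ i ≢ suc j → vertexSum (RT j a b) f (suc i) ≡ f i
leaf-sum j a b f i i≢u i≢w = vertexSum-single (RT j a b) f (inj₂ refl) λ e e≢i →
  not-incident-RT (e≢i ∘ sym ∘ FP.suc-injective) (not-parent (toℕ e))
  where
  not-parent : ∀ t → suc (toℕ i) ≢ parentIndex j a t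
  not-parent t with parent-cases j a t
  ... | inj₁ (_ , at-root)         = ℕP.1+n≢0 ∘ λ eq → trans eq at-root
  ... | inj₂ (inj₁ (_ , _ , at-u)) = i≢u ∘ ℕP.suc-injective ∘ λ eq → trans eq at-u
  ... | inj₂ (inj₂ (_ , at-w))     = i≢w ∘ ℕP.suc-injective ∘ λ eq → trans eq at-w

root-sum : ∀ j a b f → vertexSum (RT j a b) f zero ≡ sumFin (suc (suc j)) (λ i → f (i ↑ˡ (a ℕ.+ b)))
root-sum j a b f = begin
  vertexSum T f zero
    ≡⟨ sumFin-split (suc (suc j)) (a ℕ.+ b) (contribution T f zero) ⟩
  sumFin (suc (suc j)) (λ i → contribution T f zero (i ↑ˡ (a ℕ.+ b)))
    + sumFin (a ℕ.+ b) (λ i → contribution T f zero (suc (suc j) ↑ʳ i))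
    ≡⟨ cong₂ _+_ (sumFin-cong (suc (suc j)) root-edge) (sumFin-zero (a ℕ.+ b) _ other-edge) ⟩
  sumFin (suc (suc j)) (λ i → f (i ↑ˡ (a ℕ.+ b))) + 0ℤ
    ≡⟨ ℤP.+-identityʳ _ ⟩
  sumFin (suc (suc j)) (λ i → f (i ↑ˡ (a ℕ.+ b)))
    ∎
  where
  open ≡-Reasoning
  T : Graph
  T = RT j a b
  root-edge : ∀ i → contribution T f zero (i ↑ˡ (a ℕ.+ b)) ≡ f (i ↑ˡ (a ℕ.+ b))
  root-edge i = contribution-present T f (incident-parent (sym (parent-root
    (subst (_< suc (suc j)) (sym (FP.toℕ-↑ˡ i (a ℕ.+ b))) (FP.toℕ<n i)))))
  beyond-root : ∀ t → suc (suc j) ≤ t → 0 ≢ parentIndex j a t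
  beyond-root t 2+j≤t with parent-cases j a t
  ... | inj₁ (t<2+j , _)           = λ _ → ℕP.<⇒≱ t<2+j 2+j≤t
  ... | inj₂ (inj₁ (_ , _ , at-u)) = λ 0≡u → ℕP.0≢1+n (trans 0≡u at-u)
  ... | inj₂ (inj₂ (_ , at-w))     = λ 0≡w → ℕP.0≢1+n (trans 0≡w at-w)
  other-edge : ∀ i → contribution T f zero (suc (suc j) ↑ʳ i) ≡ 0ℤ
  other-edge i = contribution-absent T f (not-incident-RT {j} {a} {b} (λ ())
    (beyond-root _ (subst (suc (suc j) ≤_) (sym (FP.toℕ-↑ʳ (suc (suc j)) i)) (ℕP.m≤m+n _ _))))

squeeze : ∀ {t n} → ¬ t < n → t < suc n → t ≡ n
squeeze t≮n t<1+n = ℕP.≤∧≮⇒≡ (ℕ.s≤s⁻¹ t<1+n) t≮n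

u-sum : ∀ j b f {eᵤ e꜀} → toℕ eᵤ ≡ j → toℕ e꜀ ≡ suc (suc j) →
        vertexSum (RT j 1 b) f (suc eᵤ) ≡ f eᵤ + f e꜀
u-sum j b f {eᵤ} {e꜀} eᵤ≡j e꜀≡2+j =
  vertexSum-pair (RT j 1 b) f (toℕ-distinct eᵤ≡j e꜀≡2+j (ℕP.m≢1+n+m j {1}))
    (inj₂ refl) (incident-parent c-parent) others
  where
  j+1≡1+j : j ℕ.+ 1 ≡ suc j
  j+1≡1+j = ℕP.+-comm j 1
  c-parent : toℕ (suc eᵤ) ≡ parentIndex j 1 (toℕ e꜀)
  c-parent rewrite eᵤ≡j | e꜀≡2+j =
    sym (parent-u (ℕP.n≮n _) (subst (λ n → suc (suc j) < suc (suc n)) (sym j+1≡1+j) (ℕP.n<1+n _)))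
  others : ∀ e → e ≢ eᵤ → e ≢ e꜀ → ¬ Incident (RT j 1 b) (suc eᵤ) e
  others e e≢eᵤ e≢e꜀ =
    not-incident-RT (e≢eᵤ ∘ sym ∘ FP.suc-injective) (not-parent ∘ trans (cong suc (sym eᵤ≡j)))
    where
    not-parent : suc j ≢ parentIndex j 1 (toℕ e)
    not-parent with parent-cases j 1 (toℕ e)
    ... | inj₁ (_ , at-root) = ℕP.1+n≢0 ∘ λ eq → trans eq at-root
    ... | inj₂ (inj₁ (t≮2+j , t<3+j , _)) = λ _ → e≢e꜀ (FP.toℕ-injective
            (trans (squeeze t≮2+j (subst (λ n → toℕ e < suc (suc n)) j+1≡1+j t<3+j)) (sym e꜀≡2+j)))
    ... | inj₂ (inj₂ (_ , at-w)) = ℕP.1+n≢n ∘ sym ∘ λ eq → trans eq at-w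

w-sum : ∀ j a f {eʷ eᵈ} → toℕ eʷ ≡ suc j → toℕ eᵈ ≡ suc (suc (j ℕ.+ a)) →
        vertexSum (RT j a 1) f (suc eʷ) ≡ f eʷ + f eᵈ
w-sum j a f {eʷ} {eᵈ} eʷ≡1+j eᵈ≡2+j+a =
  vertexSum-pair (RT j a 1) f (toℕ-distinct eʷ≡1+j eᵈ≡2+j+a (ℕP.m≢1+m+n (suc j)))
    (inj₂ refl) (incident-parent d-parent) others
  where
  d-parent : toℕ (suc eʷ) ≡ parentIndex j a (toℕ eᵈ)
  d-parent rewrite eʷ≡1+j | eᵈ≡2+j+a = sym (parent-w (ℕP.n≮n _))
  edge-count : q (RT j a 1) ≡ suc (suc (suc (j ℕ.+ a)))
  edge-count = cong (λ n → suc (suc n)) (trans (cong (j ℕ.+_) (ℕP.+-comm a 1)) (ℕP.+-suc j a))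
  others : ∀ e → e ≢ eʷ → e ≢ eᵈ → ¬ Incident (RT j a 1) (suc eʷ) e
  others e e≢eʷ e≢eᵈ =
    not-incident-RT (e≢eʷ ∘ sym ∘ FP.suc-injective) (not-parent ∘ trans (cong suc (sym eʷ≡1+j)))
    where
    not-parent : suc (suc j) ≢ parentIndex j a (toℕ e)
    not-parent with parent-cases j a (toℕ e)
    ... | inj₁ (_ , at-root) = ℕP.1+n≢0 ∘ λ eq → trans eq at-root
    ... | inj₂ (inj₁ (_ , _ , at-u)) = ℕP.1+n≢n ∘ λ eq → trans eq at-u
    ... | inj₂ (inj₂ (t≮2+j+a , _)) = λ _ → e≢eᵈ (FP.toℕ-injective
            (trans (squeeze t≮2+j+a (subst (toℕ e <_) edge-count (FP.toℕ<n e))) (sym eᵈ≡2+j+a)))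

opposite-distance : ∀ x y → ∣ x ∣ ≡ ∣ y ∣ → x ≢ y → ∣ x - y ∣ ≡ ∣ x ∣ ℕ.+ ∣ y ∣
opposite-distance (ℤ.+ m)     (ℤ.+ n)     m≡n x≢y = ⊥-elim (x≢y (cong ℤ.+_ m≡n))
opposite-distance (ℤ.+ m)     ℤ.-[1+ n ]  _   _   = refl
opposite-distance ℤ.-[1+ m ]  (ℤ.+ zero)  _   _   = sym (ℕP.+-identityʳ (suc m))
opposite-distance ℤ.-[1+ m ]  ℤ.+[1+ n ]  _   _   = cong suc (sym (ℕP.+-suc m n))
opposite-distance ℤ.-[1+ m ]  ℤ.-[1+ n ]  m≡n x≢y = ⊥-elim (x≢y (cong ℤ.-[1+_] (ℕP.suc-injective m≡n)))

-- The labels of v₀ and u differ by the difference of the labels of v₀ℓ and uc.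
difference-cancels : ∀ x y z → (x + y) - (y + z) ≡ x - z
difference-cancels = solve-ℤ

-- A leaf carries the label of its edge and p is even, so 0 labels v₀u or v₀w.
zero-edge-is-inner : ∀ {j a b} (σ : SuperEdgeGraceful (RT j a b)) → Even (p (RT j a b)) →
                     ∀ e → Graceful.label (RT j a b) σ e ≡ 0ℤ → toℕ e ≡ j ⊎ toℕ e ≡ suc j
zero-edge-is-inner {j} {a} {b} σ even e e↦0 with toℕ e ℕ.≟ j | toℕ e ℕ.≟ suc j
... | yes at-u | _        = inj₁ at-u
... | no _     | yes at-w = inj₂ at-w
... | no ¬u    | no ¬w    =
  ⊥-elim (vertexLabel-nonzero even (suc e) (trans (leaf-sum j a b label e ¬u ¬w) e↦0))
  where open Graceful (RT j a b) σ

-- v₀u cannot be labelled 0: u would share its label with its leaf child c.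
u-edge-nonzero : ∀ {j b} (σ : SuperEdgeGraceful (RT j 1 b)) →
                 ∀ e → toℕ e ≡ j → Graceful.label (RT j 1 b) σ e ≢ 0ℤ
u-edge-nonzero {j} {b} σ eᵤ eᵤ≡j =
  zero-summand (toℕ-distinct eᵤ≡j c≡2+j j≢2+j ∘ FP.suc-injective)
    (u-sum j b label eᵤ≡j c≡2+j) (leaf-sum j 1 b label c c≢u c≢w)
  where
  open Graceful (RT j 1 b) σ
  j≢2+j : j ≢ suc (suc j)
  j≢2+j = ℕP.m≢1+n+m j {1}
  c<q : suc (suc j) < q (RT j 1 b)
  c<q = s≤s (s≤s (ℕP.m<m+n j (s≤s z≤n)))
  c : Fin (q (RT j 1 b))
  c = fromℕ< c<q
  c≡2+j : toℕ c ≡ suc (suc j)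
  c≡2+j = FP.toℕ-fromℕ< c<q
  c≢u : toℕ c ≢ j
  c≢u c≡j = j≢2+j (trans (sym c≡j) c≡2+j)
  c≢w : toℕ c ≢ suc j
  c≢w c≡1+j = ℕP.1+n≢n (trans (sym c≡2+j) c≡1+j)

-- When b = 1, v₀w cannot be labelled 0: w would share its label with its leaf child d.
w-edge-nonzero-single : ∀ {j a} (σ : SuperEdgeGraceful (RT j a 1)) →
                        ∀ e → toℕ e ≡ suc j → Graceful.label (RT j a 1) σ e ≢ 0ℤ
w-edge-nonzero-single {j} {a} σ eʷ eʷ≡1+j =
  zero-summand (toℕ-distinct eʷ≡1+j d≡2+j+a 1+j≢2+j+a ∘ FP.suc-injective)
    (w-sum j a label eʷ≡1+j d≡2+j+a) (leaf-sum j a 1 label d d≢u d≢w)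
  where
  open Graceful (RT j a 1) σ
  1+j≢2+j+a : suc j ≢ suc (suc (j ℕ.+ a))
  1+j≢2+j+a = ℕP.m≢1+m+n (suc j)
  d<q : suc (suc (j ℕ.+ a)) < q (RT j a 1)
  d<q = s≤s (s≤s (ℕP.+-monoʳ-< j (ℕP.m<m+n a (s≤s z≤n))))
  d : Fin (q (RT j a 1))
  d = fromℕ< d<q
  d≡2+j+a : toℕ d ≡ suc (suc (j ℕ.+ a))
  d≡2+j+a = FP.toℕ-fromℕ< d<q
  d≢u : toℕ d ≢ j
  d≢u d≡j = ℕP.<⇒≢ (s≤s (ℕP.m≤n⇒m≤1+n (ℕP.m≤m+n j a))) (trans (sym d≡j) d≡2+j+a)
  d≢w : toℕ d ≢ suc j
  d≢w d≡1+j = 1+j≢2+j+a (trans (sym d≡1+j) d≡2+j+a)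

-- When j = 1, v₀w cannot be labelled 0: otherwise v₀ and u both get labels of
-- absolute value k+1, yet their labels differ by a difference of two edge labels.
w-edge-nonzero-j1 : ∀ {b} (σ : SuperEdgeGraceful (RT 1 1 b)) → Even (p (RT 1 1 b)) →
                    ¬ Even (q (RT 1 1 b)) → ∀ e → toℕ e ≡ 2 → Graceful.label (RT 1 1 b) σ e ≢ 0ℤ
w-edge-nonzero-j1 {b} σ even odd eʷ eʷ≡2 eʷ↦0 =
  ℕP.<⇒≱ (ℕP.+-mono-< (ℕP.n<1+n k) (ℕP.n<1+n k)) distance-bound
  where
  open Graceful (RT 1 1 b) σ
  k : ℕ
  k = q (RT 1 1 b) / 2
  eℓ eᵤ e꜀ : Fin (q (RT 1 1 b))
  eℓ = zero
  eᵤ = suc zero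
  e꜀ = suc (suc (suc zero))

  w↦0 : label (suc (suc zero)) ≡ 0ℤ
  w↦0 = subst (λ e → label e ≡ 0ℤ) (FP.toℕ-injective eʷ≡2) eʷ↦0

  root-label : vertexLabel zero ≡ label eℓ + label eᵤ
  root-label = begin
    vertexLabel zero                                       ≡⟨ root-sum 1 1 b label ⟩
    label eℓ + (label eᵤ + (label (suc (suc zero)) + 0ℤ)) ≡⟨ cong (λ x → label eℓ + (label eᵤ + (x + 0ℤ))) w↦0 ⟩
    label eℓ + (label eᵤ + 0ℤ)                            ≡⟨ cong (label eℓ +_) (ℤP.+-identityʳ (label eᵤ)) ⟩
    label eℓ + label eᵤ                                    ∎
    where open ≡-Reasoning

  u-label : vertexLabel (suc eᵤ) ≡ label eᵤ + label e꜀
  u-label = u-sum 1 b label refl refl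

  ℓ-label : vertexLabel (suc eℓ) ≡ label eℓ
  ℓ-label = leaf-sum 1 1 b label eℓ (λ ()) (λ ())

  c-label : vertexLabel (suc e꜀) ≡ label e꜀
  c-label = leaf-sum 1 1 b label e꜀ (λ ()) (λ ())

  -- Labels of absolute value ≤ k are 0, edge labels of leaves, or the label
  -- of v₀u; so a non-leaf vertex not labelled like v₀u has label ±(k+1).
  extreme : ∀ v → (∀ e → toℕ e ≢ 1 → toℕ e ≢ 2 → v ≢ suc e) → vertexLabel v ≢ label eᵤ →
            ∣ vertexLabel v ∣ ≡ suc k
  extreme v not-leaf v≢ᵤ with ∣ vertexLabel v ∣ ℕP.≤? k
  ... | no large  = ℕP.≤-antisym (vertexLabel-bound refl v) (ℕP.≰⇒> large)
  ... | yes small = ⊥-elim (not-edge-label (label-onto odd (vertexLabel v) small))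
    where
    leaf-label : ∀ e → toℕ e ≢ 1 → toℕ e ≢ 2 → label e ≢ vertexLabel v
    leaf-label e ¬u ¬w e↦v =
      not-leaf e ¬u ¬w (vertexLabel-injective (trans (sym e↦v) (sym (leaf-sum 1 1 b label e ¬u ¬w))))
    not-edge-label : ¬ (∃ λ e → label e ≡ vertexLabel v)
    not-edge-label (zero , e↦v)              = leaf-label zero (λ ()) (λ ()) e↦v
    not-edge-label (suc zero , e↦v)          = v≢ᵤ (sym e↦v)
    not-edge-label (suc (suc zero) , e↦v)    = vertexLabel-nonzero even v (trans (sym e↦v) w↦0)
    not-edge-label (suc (suc (suc e)) , e↦v) = leaf-label (suc (suc (suc e))) (λ ()) (λ ()) e↦v

  root-extreme : ∣ vertexLabel zero ∣ ≡ suc k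
  root-extreme = extreme zero (λ _ _ _ ()) λ root↦ᵤ →
    vertexLabel-nonzero even (suc eℓ)
      (trans ℓ-label (identityˡ-unique (label eℓ) (label eᵤ) (trans (sym root-label) root↦ᵤ)))

  u-extreme : ∣ vertexLabel (suc eᵤ) ∣ ≡ suc k
  u-extreme = extreme (suc eᵤ) (λ e ¬u _ u≡e → ¬u (cong toℕ (sym (FP.suc-injective u≡e)))) λ u↦ᵤ →
    vertexLabel-nonzero even (suc e꜀)
      (trans c-label (identityʳ-unique (label eᵤ) (label e꜀) (trans (sym u-label) u↦ᵤ)))

  root≢u : vertexLabel zero ≢ vertexLabel (suc eᵤ)
  root≢u = FP.0≢1+n ∘ vertexLabel-injective {zero} {suc eᵤ}

  distance-bound : suc k ℕ.+ suc k ≤ k ℕ.+ k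
  distance-bound = begin
    suc k ℕ.+ suc k
      ≡⟨ cong₂ ℕ._+_ (sym root-extreme) (sym u-extreme) ⟩
    ∣ vertexLabel zero ∣ ℕ.+ ∣ vertexLabel (suc eᵤ) ∣
      ≡⟨ sym (opposite-distance _ _ (trans root-extreme (sym u-extreme)) root≢u) ⟩
    ∣ vertexLabel zero - vertexLabel (suc eᵤ) ∣
      ≡⟨ cong ∣_∣ (trans (cong₂ _-_ root-label u-label) (difference-cancels (label eℓ) (label eᵤ) (label e꜀))) ⟩
    ∣ label eℓ - label e꜀ ∣
      ≤⟨ ℤP.∣i-j∣≤∣i∣+∣j∣ (label eℓ) (label e꜀) ⟩
    ∣ label eℓ ∣ ℕ.+ ∣ label e꜀ ∣
      ≤⟨ ℕP.+-mono-≤ (label-bound eℓ) (label-bound e꜀) ⟩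
    k ℕ.+ k
      ∎
    where open ℕP.≤-Reasoning

w-edge-nonzero : ∀ {j b} → j ≡ 1 ⊎ b ≡ 1 → (σ : SuperEdgeGraceful (RT j 1 b)) →
                 Even (p (RT j 1 b)) → ¬ Even (q (RT j 1 b)) →
                 ∀ e → toℕ e ≡ suc j → Graceful.label (RT j 1 b) σ e ≢ 0ℤ
w-edge-nonzero (inj₁ refl) σ even odd = w-edge-nonzero-j1 σ even odd
w-edge-nonzero (inj₂ refl) σ _    _   = w-edge-nonzero-single σ

vertex-count : ∀ c d → ℕ.suc (ℕ.suc (ℕ.suc (ℕ.suc (2 ℕ.* c) ℕ.+ (1 ℕ.+ ℕ.suc (2 ℕ.* d)))))
                       ≡ 2 ℕ.* (3 ℕ.+ c ℕ.+ d)
vertex-count = solve-ℕ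

edge-count : ∀ c d → ℕ.suc (ℕ.suc (ℕ.suc (2 ℕ.* c) ℕ.+ (1 ℕ.+ ℕ.suc (2 ℕ.* d))))
                     ≡ ℕ.suc (2 ℕ.* (2 ℕ.+ c ℕ.+ d))
edge-count = solve-ℕ

rt-parity : ∀ {j b} → Odd j → Odd b → Even (p (RT j 1 b)) × ¬ Even (q (RT j 1 b))
rt-parity (c , refl) (d , refl) =
  (3 ℕ.+ c ℕ.+ d , vertex-count c d) ,
  λ (m , q≡2m) → ℕP.even≢odd m (2 ℕ.+ c ℕ.+ d) (trans (sym q≡2m) (edge-count c d))

-- Some edge is labelled 0; it must join v₀ to u or to w, and neither is possible.
lemma5 : (j b : ℕ) → Odd j → Odd b → (j ≡ 1 ⊎ b ≡ 1) →
         ¬ SuperEdgeGraceful (RT j 1 b)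
lemma5 j b odd-j odd-b shape σ with rt-parity odd-j odd-b
... | even , odd with Graceful.zero-edge (RT j 1 b) σ odd
...   | e₀ , e₀↦0 with zero-edge-is-inner σ even e₀ e₀↦0
...     | inj₁ at-u = u-edge-nonzero σ e₀ at-u e₀↦0
...     | inj₂ at-w = w-edge-nonzero shape σ even odd e₀ at-w e₀↦0
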